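{- For every integer $k\in\mathbb{Z}$ there exist a finite graph $G$ and a spanning subgraph $H$ of $G$ such that $\iota_{\rm g}(G)-\iota_{\rm g}(H)=k$.
   Context: All graphs are finite and simple; $N[S]$ denotes the closed neighborhood of a vertex set $S$. In the isolation game on $G$, Dominator and Staller alternately choose vertices of $G$, Dominator first; if $S$ is the set of already chosen vertices, a vertex $x$ may be chosen only if it equals or is adjacent to some vertex $y$ lying in a component of $G-N[S]$ that has at least one edge. The game ends when no such vertex exists (i.e. $G-N[S]$ is edgeless). Dominator wants to minimize the number of chosen vertices, Staller wants to maximize it. $\iota_{\rm g}(G)$ is the number of chosen vertices under optimal play. -}

module Defs where

open import Data.Bool using (Bool; true; false; _∧_; _∨_; not)
open import Data.Nat using (ℕ; zero; suc; _⊓_; _⊔_)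
open import Data.Fin using (Fin; _≟_)
open import Data.List using (List; []; _∷_; map; foldr; filter; allFin)
open import Data.Bool.ListAction using (any)
open import Relation.Nullary.Decidable using (⌊_⌋)
open import Relation.Binary.PropositionalEquality using (_≡_)

record Graph (n : ℕ) : Set where
  field
    adj    : Fin n → Fin n → Bool
    sym    : ∀ u v → adj u v ≡ adj v u
    irrefl : ∀ v → adj v v ≡ false
open Graph public

SpanningSubgraph : {n : ℕ} → Graph n → Graph n → Set
SpanningSubgraph {n} H G = ∀ (u v : Fin n) → adj H u v ≡ true → adj G u v ≡ true

module _ {n : ℕ} (G : Graph n) where

  eqB : Fin n → Fin n → Bool
  eqB u v = ⌊ u ≟ v ⌋

  inN : List (Fin n) → Fin n → Bool
  inN S v = any (λ s → eqB s v ∨ adj G s v) S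

  -- y lies in G - N[S] and its component there contains an edge,
  -- i.e. y has a neighbour z in G - N[S]
  inNontrivialComp : List (Fin n) → Fin n → Bool
  inNontrivialComp S y =
    not (inN S y) ∧ any (λ z → not (inN S z) ∧ adj G y z) (allFin n)

  legal : List (Fin n) → Fin n → Bool
  legal S x = any (λ y → inNontrivialComp S y ∧ (eqB x y ∨ adj G x y)) (allFin n)

  legalMoves : List (Fin n) → List (Fin n)
  legalMoves S = filter (λ x → legal S x ≡? true) (allFin n)
    where
      open import Data.Bool.Properties using () renaming (_≟_ to _≡?_)

  -- optimal number of further moves from position S;
  -- the Bool says whose turn it is (true = Dominator, who minimises).
  -- The fuel bounds the game length; every legal move is a new vertex,
  -- so fuel n suffices for the full game.
  value : ℕ → Bool → List (Fin n) → ℕ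
  value zero    _     S = zero
  value (suc f) d S with map (λ x → value f (not d) (x ∷ S)) (legalMoves S)
  ... | []     = zero
  ... | v ∷ vs = suc (foldr (if d then _⊓_ else _⊔_) v vs)
    where
      open import Data.Bool using (if_then_else_)

ιg : {n : ℕ} → Graph n → ℕ
ιg {n} G = value G n true []

{-# OPTIONS --safe #-}

-- Proof idea: if G is a disjoint union of cliques, each with at least two
-- vertices, then a vertex is a legal move exactly when no vertex of its clique
-- has been chosen, and choosing it closes exactly that clique.  So every play
-- lasts as many moves as there are cliques, whatever the players do.  Hence
-- ι_g(mK₂) = m, ι_g(K_{2m}) = 1 for m ≥ 1, and ι_g of an edgeless graph is 0;
-- the spanning pairs (mK₂, edgeless) and (K_{2m}, mK₂) realise k = m and k = 1 − m.
module Submission where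

open import Defs
open import Data.Nat using (ℕ)
open import Data.Integer using (ℤ; +_; _-_)
open import Data.Product using (Σ; ∃-syntax; _×_)
open import Relation.Binary.PropositionalEquality using (_≡_)

open import Data.Bool using (Bool; true; false; _∧_; _∨_; not; if_then_else_)
open import Data.Bool.Properties using (T-≡; ∧-identityʳ; ∧-zeroʳ) renaming (_≟_ to _≟ᵇ_)
open import Data.Bool.ListAction using (any; or)
open import Data.Nat using (zero; suc; _+_; _≤_; _⊓_; _⊔_; z≤n; s≤s⁻¹)
open import Data.Nat.Properties using (n≤0⇒n≡0; 0≢1+n; suc-injective; +-suc; ⊓-idem; ⊔-idem)
open import Data.Integer using (-[1+_])
open import Data.Integer.Properties using (+-identityʳ)
open import Data.Fin as F using (Fin; _≟_; splitAt; _↑ˡ_; _↑ʳ_)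
open import Data.Fin.Properties as F using (splitAt-↑ˡ; splitAt-↑ʳ; injective⇒≤)
open import Data.List using (List; []; _∷_; map; foldr; allFin)
open import Data.List.Properties using (map-cong; filter-none; foldr-preservesᵇ)
open import Data.List.Relation.Unary.All as All using (All; []; _∷_)
open import Data.List.Relation.Unary.All.Properties using (map⁺; tabulate⁺)
open import Data.List.Relation.Unary.Any.Properties using (any⁺)
open import Data.List.Membership.Propositional using (_∈_; lose)
open import Data.List.Membership.Propositional.Properties using (∈-filter⁺; ∈-filter⁻; ∈-allFin; ∈-map⁺)
open import Data.Product using (_,_; proj₁; proj₂; ∃₂)
open import Data.Sum using (reduce)
open import Function using (_∘_; Equivalence; mk⇔)
open import Relation.Nullary using (¬_; yes; no; contradiction)
open import Relation.Nullary.Decidable using (Dec; ⌊_⌋; isYes≗does; dec-true; dec-false; does-⇔)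
open import Relation.Binary.PropositionalEquality using (_≢_; refl; trans; cong; cong₂; subst; module ≡-Reasoning)
  renaming (sym to ≡-sym)

any-true : ∀ {A : Set} (p : A → Bool) {x xs} → x ∈ xs → p x ≡ true → any p xs ≡ true
any-true p x∈xs px = Equivalence.to T-≡ (any⁺ p (lose x∈xs (Equivalence.from T-≡ px)))

any-false : ∀ {A : Set} (p : A → Bool) xs → (∀ x → p x ≡ false) → any p xs ≡ false
any-false p []       _     = refl
any-false p (x ∷ xs) px≡false rewrite px≡false x = any-false p xs px≡false

any-cong : ∀ {A : Set} {p q : A → Bool} → (∀ x → p x ≡ q x) → ∀ xs → any p xs ≡ any q xs
any-cong p≗q xs = cong or (map-cong p≗q xs)

⌊⌋-true : ∀ {A : Set} (a? : Dec A) → A → ⌊ a? ⌋ ≡ true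
⌊⌋-true a? a = trans (isYes≗does a?) (dec-true a? a)

⌊⌋-false : ∀ {A : Set} (a? : Dec A) → ¬ A → ⌊ a? ⌋ ≡ false
⌊⌋-false a? ¬a = trans (isYes≗does a?) (dec-false a? ¬a)

⌊≟⌋-sym : ∀ {k} (a b : Fin k) → ⌊ a ≟ b ⌋ ≡ ⌊ b ≟ a ⌋
⌊≟⌋-sym a b = trans (isYes≗does (a ≟ b))
                (trans (does-⇔ (mk⇔ ≡-sym ≡-sym) (a ≟ b) (b ≟ a)) (≡-sym (isYes≗does (b ≟ a))))

countTrue : ∀ {m} → (Fin m → Bool) → ℕ
countTrue {zero}  p = 0
countTrue {suc m} p = (if p F.zero then 1 else 0) + countTrue (p ∘ F.suc)

countTrue-cong : ∀ {m} {p q : Fin m → Bool} → (∀ i → p i ≡ q i) → countTrue p ≡ countTrue q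
countTrue-cong {zero}  p≗q = refl
countTrue-cong {suc m} p≗q =
  cong₂ (λ b n → (if b then 1 else 0) + n) (p≗q F.zero) (countTrue-cong (p≗q ∘ F.suc))

countTrue-remove : ∀ {m} {p q : Fin m → Bool} c → p c ≡ true → q c ≡ false →
                   (∀ i → i ≢ c → p i ≡ q i) → countTrue p ≡ suc (countTrue q)
countTrue-remove {suc m} F.zero pc qc agree rewrite pc | qc =
  cong suc (countTrue-cong (λ i → agree (F.suc i) (λ ())))
countTrue-remove {suc m} {p} {q} (F.suc c) pc qc agree rewrite agree F.zero (λ ()) =
  trans (cong (λ n → (if q F.zero then 1 else 0) + n) (countTrue-remove c pc qc agreeᵗ)) (+-suc _ _)
  where
    agreeᵗ : ∀ i → i ≢ c → p (F.suc i) ≡ q (F.suc i)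
    agreeᵗ i i≢c = agree (F.suc i) (i≢c ∘ F.suc-injective)

countTrue-positive : ∀ {m} {p : Fin m → Bool} {k} → countTrue p ≡ suc k → ∃[ i ] p i ≡ true
countTrue-positive {suc m} {p} eq with p F.zero in p0
... | true  = F.zero , p0
... | false with countTrue-positive eq
...   | i , pi = F.suc i , pi

countTrue-true : ∀ m → countTrue {m} (λ _ → true) ≡ m
countTrue-true zero    = refl
countTrue-true (suc m) = cong suc (countTrue-true m)

best : Bool → ℕ → ℕ → ℕ
best d = if d then _⊓_ else _⊔_

best-idem : ∀ d q → best d q q ≡ q
best-idem true  = ⊓-idem
best-idem false = ⊔-idem

valueStep : Bool → List ℕ → ℕ
valueStep d []       = 0
valueStep d (v ∷ vs) = suc (foldr (best d) v vs)

valueStep-constant : ∀ d {q w} vs → w ∈ vs → All (_≡ q) vs → valueStep d vs ≡ suc q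
valueStep-constant d {q} (v ∷ vs) _ (v≡q ∷ vs≡q) =
  cong suc (foldr-preservesᵇ (λ { refl refl → best-idem d q }) v≡q vs≡q)

module _ {n : ℕ} (G : Graph n) where

  legalMoves-sound : ∀ S {x} → x ∈ legalMoves G S → legal G S x ≡ true
  legalMoves-sound S = proj₂ ∘ ∈-filter⁻ (λ x → legal G S x ≟ᵇ true) {xs = allFin n}

  legalMoves-complete : ∀ S {x} → legal G S x ≡ true → x ∈ legalMoves G S
  legalMoves-complete S {x} = ∈-filter⁺ (λ x → legal G S x ≟ᵇ true) (∈-allFin x)

  legalMoves-none : ∀ S → (∀ x → legal G S x ≢ true) → legalMoves G S ≡ []
  legalMoves-none S illegal = filter-none (λ x → legal G S x ≟ᵇ true) (tabulate⁺ illegal)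

  value-suc : ∀ f d S →
    value G (suc f) d S ≡ valueStep d (map (λ x → value G f (not d) (x ∷ S)) (legalMoves G S))
  value-suc f d S with map (λ x → value G f (not d) (x ∷ S)) (legalMoves G S)
  ... | []    = refl
  ... | _ ∷ _ = refl

record ExactPotential {n : ℕ} (G : Graph n) : Set where
  field
    potential       : List (Fin n) → ℕ
    move-decrements : ∀ S x → legal G S x ≡ true → potential S ≡ suc (potential (x ∷ S))
    positive⇒move   : ∀ S {q} → potential S ≡ suc q → ∃[ x ] legal G S x ≡ true

module _ {n : ℕ} {G : Graph n} (Φ : ExactPotential G) where
  open ExactPotential Φ

  value≡potential : ∀ f d S → potential S ≤ f → value G f d S ≡ potential S
  value≡potential zero    d S Φ≤0 = ≡-sym (n≤0⇒n≡0 Φ≤0)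
  value≡potential (suc f) d S Φ≤f with potential S in ΦS
  ... | zero  = trans (value-suc G f d S) (cong (valueStep d ∘ map _) (legalMoves-none G S noMove))
    where
      noMove : ∀ x → legal G S x ≢ true
      noMove x lx = 0≢1+n (trans (≡-sym ΦS) (move-decrements S x lx))
  ... | suc q = trans (value-suc G f d S)
                      (valueStep-constant d _ (∈-map⁺ _ someMove) (map⁺ (All.tabulate successor)))
    where
      someMove : proj₁ (positive⇒move S ΦS) ∈ legalMoves G S
      someMove = legalMoves-complete G S (proj₂ (positive⇒move S ΦS))
      successor : ∀ {x} → x ∈ legalMoves G S → value G f (not d) (x ∷ S) ≡ q
      successor {x} x∈ =
        trans (value≡potential f (not d) (x ∷ S) (subst (_≤ f) (≡-sym Φx) (s≤s⁻¹ Φ≤f))) Φx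
        where
          Φx : potential (x ∷ S) ≡ q
          Φx = suc-injective (trans (≡-sym (move-decrements S x (legalMoves-sound G S x∈))) ΦS)

  ιg≡potential : potential [] ≤ n → ιg G ≡ potential []
  ιg≡potential = value≡potential n true []

cliqueUnion : ∀ {n m} → (Fin n → Fin m) → Graph n
cliqueUnion cls = record
  { adj    = λ u v → ⌊ cls u ≟ cls v ⌋ ∧ not ⌊ u ≟ v ⌋
  ; sym    = λ u v → cong₂ (λ a b → a ∧ not b) (⌊≟⌋-sym (cls u) (cls v)) (⌊≟⌋-sym u v)
  ; irrefl = λ v → trans (cong (λ b → ⌊ cls v ≟ cls v ⌋ ∧ not b) (⌊⌋-true (v ≟ v) refl)) (∧-zeroʳ _)
  }

module _ {n m : ℕ} (cls : Fin n → Fin m) where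

  hit : List (Fin n) → Fin m → Bool
  hit S c = any (λ s → ⌊ cls s ≟ c ⌋) S

  closedAdj≡sameClass : ∀ u v → (⌊ u ≟ v ⌋ ∨ adj (cliqueUnion cls) u v) ≡ ⌊ cls u ≟ cls v ⌋
  closedAdj≡sameClass u v with u ≟ v
  ... | yes refl = ≡-sym (⌊⌋-true (cls u ≟ cls u) refl)
  ... | no _     = ∧-identityʳ _

  inN≡hit : ∀ S v → inN (cliqueUnion cls) S v ≡ hit S (cls v)
  inN≡hit S v = any-cong (λ s → closedAdj≡sameClass s v) S

  module _ (twoInEachClass : ∀ c → ∃₂ λ u v → u ≢ v × cls u ≡ c × cls v ≡ c) where

    mate : ∀ y → ∃[ z ] y ≢ z × cls z ≡ cls y
    mate y with twoInEachClass (cls y)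
    ... | u , v , u≢v , u∈c , v∈c with y ≟ u
    ...   | yes refl = v , u≢v , trans v∈c (≡-sym u∈c)
    ...   | no y≢u   = u , y≢u , u∈c

    rep : Fin m → Fin n
    rep c = proj₁ (twoInEachClass c)

    cls-rep : ∀ c → cls (rep c) ≡ c
    cls-rep c with twoInEachClass c
    ... | _ , _ , _ , u∈c , _ = u∈c

    inNontrivialComp≡unhit : ∀ S y → inNontrivialComp (cliqueUnion cls) S y ≡ not (hit S (cls y))
    inNontrivialComp≡unhit S y rewrite inN≡hit S y with hit S (cls y) in hitY
    ... | true  = refl
    ... | false with mate y
    ...   | z , y≢z , z~y = any-true _ (∈-allFin z) (cong₂ _∧_ z-outside y-adj-z)
      where
        z-outside : not (inN (cliqueUnion cls) S z) ≡ true
        z-outside = cong not (trans (inN≡hit S z) (trans (cong (hit S) z~y) hitY))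
        y-adj-z : adj (cliqueUnion cls) y z ≡ true
        y-adj-z =
          cong₂ (λ a b → a ∧ not b) (⌊⌋-true (cls y ≟ cls z) (≡-sym z~y)) (⌊⌋-false (y ≟ z) y≢z)

    legal≡unhit : ∀ S x → legal (cliqueUnion cls) S x ≡ not (hit S (cls x))
    legal≡unhit S x = trans (any-cong inClassOfx (allFin n)) (unhitClassOf x)
      where
        inClassOfx : ∀ y → inNontrivialComp (cliqueUnion cls) S y ∧ (⌊ x ≟ y ⌋ ∨ adj (cliqueUnion cls) x y)
                           ≡ not (hit S (cls y)) ∧ ⌊ cls x ≟ cls y ⌋
        inClassOfx y = cong₂ _∧_ (inNontrivialComp≡unhit S y) (closedAdj≡sameClass x y)
        unhitClassOf : ∀ x → any (λ y → not (hit S (cls y)) ∧ ⌊ cls x ≟ cls y ⌋) (allFin n)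
                             ≡ not (hit S (cls x))
        unhitClassOf x with hit S (cls x) in hitX
        ... | false = any-true _ (∈-allFin x) (cong₂ _∧_ (cong not hitX) (⌊⌋-true (cls x ≟ cls x) refl))
        ... | true  = any-false _ (allFin n) outsideClass
          where
            outsideClass : ∀ y → not (hit S (cls y)) ∧ ⌊ cls x ≟ cls y ⌋ ≡ false
            outsideClass y with cls x ≟ cls y
            ... | yes x~y = trans (∧-identityʳ _) (cong not (trans (cong (hit S) (≡-sym x~y)) hitX))
            ... | no _    = ∧-zeroʳ _

    unhitClasses : ExactPotential (cliqueUnion cls)
    unhitClasses = record
      { potential       = λ S → countTrue (not ∘ hit S)
      ; move-decrements = λ S x lx →
          countTrue-remove (cls x) (trans (≡-sym (legal≡unhit S x)) lx)
            (cong (λ b → not (b ∨ hit S (cls x))) (⌊⌋-true (cls x ≟ cls x) refl))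
            (λ c c≢x → cong (λ b → not (b ∨ hit S c)) (≡-sym (⌊⌋-false (cls x ≟ c) (c≢x ∘ ≡-sym))))
      ; positive⇒move   = λ S eq → classMember S (countTrue-positive eq)
      }
      where
        classMember : ∀ S → ∃[ c ] not (hit S c) ≡ true → ∃[ x ] legal (cliqueUnion cls) S x ≡ true
        classMember S (c , unhit) =
          rep c , trans (legal≡unhit S (rep c)) (subst (λ c → not (hit S c) ≡ true) (≡-sym (cls-rep c)) unhit)

    classes≤vertices : m ≤ n
    classes≤vertices = injective⇒≤ {f = rep} λ {a} {b} eq →
      trans (≡-sym (cls-rep a)) (trans (cong cls eq) (cls-rep b))

    ιg-cliqueUnion : ιg (cliqueUnion cls) ≡ m
    ιg-cliqueUnion = begin
      ιg (cliqueUnion cls)             ≡⟨ ιg≡potential unhitClasses potential≤n ⟩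
      countTrue (λ (_ : Fin m) → true) ≡⟨ countTrue-true m ⟩
      m                                ∎
      where
        open ≡-Reasoning
        potential≤n = subst (_≤ n) (≡-sym (countTrue-true m)) classes≤vertices

matchingClass : ∀ m → Fin (m + m) → Fin m
matchingClass m = reduce ∘ splitAt m

matching : ∀ m → Graph (m + m)
matching m = cliqueUnion (matchingClass m)

ιg-matching : ∀ m → ιg (matching m) ≡ m
ιg-matching m = ιg-cliqueUnion (matchingClass m) λ c →
  c ↑ˡ m , m ↑ʳ c , halvesDiffer c , cong reduce (splitAt-↑ˡ m c m) , cong reduce (splitAt-↑ʳ m m c)
  where
    halvesDiffer : ∀ c → c ↑ˡ m ≢ m ↑ʳ c
    halvesDiffer c eq with trans (≡-sym (splitAt-↑ˡ m c m)) (trans (cong (splitAt m) eq) (splitAt-↑ʳ m m c))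
    ... | ()

complete : ∀ n → Graph n
complete n = cliqueUnion {m = 1} (λ _ → F.zero)

ιg-complete : ∀ t → ιg (complete (suc (suc t))) ≡ 1
ιg-complete t =
  ιg-cliqueUnion (λ _ → F.zero) λ { F.zero → F.zero , F.suc F.zero , (λ ()) , refl , refl }

⊆-complete : ∀ {n} (G : Graph n) → SpanningSubgraph G (complete n)
⊆-complete G u v uv =
  cong not (⌊⌋-false (u ≟ v) λ { refl → contradiction (trans (≡-sym uv) (irrefl G u)) λ () })

edgeless : ∀ n → Graph n
edgeless n = record { adj = λ _ _ → false ; sym = λ _ _ → refl ; irrefl = λ _ → refl }

ιg-edgeless : ∀ n → ιg (edgeless n) ≡ 0
ιg-edgeless n = ιg≡potential noMoves z≤n
  where
    isolated : ∀ S y → inNontrivialComp (edgeless n) S y ≡ false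
    isolated S y =
      trans (cong (not (inN (edgeless n) S y) ∧_) (any-false _ (allFin n) (λ _ → ∧-zeroʳ _))) (∧-zeroʳ _)
    illegal : ∀ S x → legal (edgeless n) S x ≡ false
    illegal S x = any-false _ (allFin n) λ y → cong (_∧ _) (isolated S y)
    noMoves : ExactPotential (edgeless n)
    noMoves = record
      { potential       = λ _ → 0
      ; move-decrements = λ S x lx → contradiction (trans (≡-sym (illegal S x)) lx) λ ()
      ; positive⇒move   = λ _ ()
      }

mainTheorem6 : (k : ℤ) → ∃[ n ] Σ (Graph n) (λ G → Σ (Graph n) (λ H →
                 SpanningSubgraph H G × ((+ ιg G) - (+ ιg H) ≡ k)))
mainTheorem6 (+ m)     = m + m , matching m , edgeless (m + m) , (λ _ _ ()) ,
  trans (cong₂ (λ a b → + a - + b) (ιg-matching m) (ιg-edgeless (m + m))) (+-identityʳ (+ m))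
mainTheorem6 -[1+ t ] = m + m , complete (m + m) , matching m , ⊆-complete (matching m) ,
  -- + 1 - + (2 + t) computes to -[1+ t ]
  cong₂ (λ a b → + a - + b) (ιg-complete _) (ιg-matching m)
  where
    m = suc (suc t)
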